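{- Let $(\mathcal V,\mathcal T_\#)$ be a natural space derived from $(V,\#,\preccurlyeq)$ with maximal dot $\top$, and let $V^{\wr}$, $\preccurlyeq^*$, $\#^*$ be as in the context. Then: (i) $(V^{\wr},\#^*,\preccurlyeq^*)$ is a pre-natural space and its space of points $\mathcal V^{\wr}$ with the apartness topology is a natural space (the trail space); (ii) the trail space is homeomorphic to $(\mathcal V,\mathcal T_\#)$: the map $p\mapsto(\psi_p(0),\psi_p(1),\psi_p(2),\dots)$ is a homeomorphism, with inverse induced by the refinement morphism sending the empty trail to $\top$ and a nonempty trail $a_0,\dots,a_n$ to $a_n$; (iii) every trail morphism from $(\mathcal V,\mathcal T_\#)$ to a natural space $(\mathcal W,\mathcal T')$ is continuous.
   Context: Setting: Bishop-style constructive mathematics. Pre-natural space: triple $(V,\#,\preccurlyeq)$, $V$ countable, $\#,\preccurlyeq$ decidable, $\#$ symmetric irreflexive, $\preccurlyeq$ a partial order, $a\preccurlyeq b\wedge c\#b\Rightarrow c\#a$; $a\prec b$ means $a\preccurlyeq b, a\ne b$. Point: sequence $(p_n)$ in $V$ with $p_{n+1}\preccurlyeq p_n$, for each $n$ some $m$ with $p_m\prec p_n$, and for all $a\#b$ some $m$ with $p_m\#a$ or $p_m\#b$; $\mathcal V$ set of points; $p\#q$ iff $p_n\#q_n$ for some $n$, $p\equiv q$ iff not $p\#q$; $\hat a=\{p:\exists m\,p_m\prec a\}$; $U$ open iff for all $x\in U,y\in\mathcal V$ one can determine $y\#x$ or $\widehat{y_m}\subseteq U$ for some $m$. Natural space: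 there is a maximal dot $\top$ and each $\hat a$ is inhabited. Homeomorphisms are understood with points identified up to $\equiv$. Refinement morphism from $(V,\#_1,\preccurlyeq_1)$ to $(W,\#_2,\preccurlyeq_2)$: $f:V\to W$ with $f(a)\#_2f(b)\Rightarrow a\#_1b$, $a\preccurlyeq_1 b\Rightarrow f(a)\preccurlyeq_2 f(b)$, and $(f(p_n))_n$ a point for every point $p$. Trails: for a finite sequence $a_0\succcurlyeq a_1\succcurlyeq\dots\succcurlyeq a_{n-1}$ its $\prec$-trail is the subsequence obtained by deleting repetitions (a strictly decreasing sequence). For a point $p$, $\psi_p(n)$ is the $\prec$-trail of $p_0,\dots,p_{n-1}$. $V^{\wr}=\{\psi_p(n):n\in\mathbb N,p\in\mathcal V\}$ (including the empty sequence, which is the maximal dot). For trails $a,b$: $a\preccurlyeq^* b$ iff $a=b\star c$ for some trail $c$ ($\star$ = concatenation, i.e. $b$ is an initial segment of $a$); $a\#^*b$ iff $a,b$ are nonempty and their last elements are apart. A trail morphism from $(\mathcal V,\mathcal T_\#)$ to $(\mathcal W,\mathcal T')$ is a refinement morphism $f$ from the trail space to $(\mathcal W,\mathcal T')$; it acts on $p\in\mathcal V$ by $f(p)=(f(\psi_p(0)),f(\psi_p(1)),\dots)$. -}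

module Defs where

open import Data.Nat using (ℕ; suc)
open import Data.Product using (Σ; ∃; _×_; _,_; proj₁; proj₂)
open import Data.Sum using (_⊎_)
open import Data.List using (List; []; _++_; applyUpTo; deduplicate; last)
open import Data.Maybe using (Maybe; just; nothing)
open import Relation.Nullary using (¬_; Dec; yes; no)
open import Relation.Binary.PropositionalEquality using (_≡_; refl)
open import Function using (_∘_)

record Triple : Set₁ where
  constructor triple
  field
    V   : Set
    _#_ : V → V → Set
    _≼_ : V → V → Set

  _≺_ : V → V → Set
  a ≺ b = (a ≼ b) × ¬ (a ≡ b)

record IsPreNatural (T : Triple) : Set where
  open Triple T
  field
    -- V countable (Bishop): a function from ℕ onto V
    enum       : ℕ → V
    enum-onto  : ∀ v → ∃ λ n → enum n ≡ v
    #-dec      : ∀ a b → Dec (a # b)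
    ≼-dec      : ∀ a b → Dec (a ≼ b)
    #-sym      : ∀ {a b} → a # b → b # a
    #-irrefl   : ∀ a → ¬ (a # a)
    ≼-refl     : ∀ a → a ≼ a
    ≼-trans    : ∀ {a b c} → a ≼ b → b ≼ c → a ≼ c
    ≼-antisym  : ∀ {a b} → a ≼ b → b ≼ a → a ≡ b
    ≼-#        : ∀ {a b c} → a ≼ b → c # b → c # a

  _≟_ : ∀ (a b : V) → Dec (a ≡ b)
  a ≟ b with ≼-dec a b | ≼-dec b a
  ... | yes ab | yes ba = yes (≼-antisym ab ba)
  ... | no ¬ab | _      = no λ { refl → ¬ab (≼-refl a) }
  ... | yes _  | no ¬ba = no λ { refl → ¬ba (≼-refl a) }

module _ (T : Triple) where
  open Triple T

  record IsPoint (p : ℕ → V) : Set where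
    field
      descending : ∀ n → p (suc n) ≼ p n
      shrinking  : ∀ n → ∃ λ m → p m ≺ p n
      locating   : ∀ a b → a # b → ∃ λ m → (p m # a) ⊎ (p m # b)

  Point : Set
  Point = Σ (ℕ → V) IsPoint

  _#ₚ_ : Point → Point → Set
  p #ₚ q = ∃ λ n → proj₁ p n # proj₁ q n

  _≡ₚ_ : Point → Point → Set
  p ≡ₚ q = ¬ (p #ₚ q)

  hat : V → Point → Set
  hat a p = ∃ λ m → proj₁ p m ≺ a

  IsOpen : (Point → Set) → Set
  IsOpen U = ∀ (x y : Point) → U x →
               (y #ₚ x) ⊎ (∃ λ m → ∀ z → hat (proj₁ y m) z → U z)

record IsNatural (T : Triple) : Set where
  open Triple T
  field
    preNatural    : IsPreNatural T
    top           : V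
    top-max       : ∀ a → a ≼ top
    hat-inhabited : ∀ a → Σ (Point T) (hat T a)

record IsRefinementMorphism (T₁ T₂ : Triple) (f : Triple.V T₁ → Triple.V T₂) : Set where
  open Triple T₁ renaming (_#_ to _#₁_; _≼_ to _≼₁_)
  open Triple T₂ renaming (_#_ to _#₂_; _≼_ to _≼₂_)
  field
    reflects-# : ∀ {a b} → f a #₂ f b → a #₁ b
    preserves-≼ : ∀ {a b} → a ≼₁ b → f a ≼₂ f b
    preserves-point : (p : Point T₁) → IsPoint T₂ (f ∘ proj₁ p)

inducedMap : (T₁ T₂ : Triple) (f : Triple.V T₁ → Triple.V T₂) →
             IsRefinementMorphism T₁ T₂ f → Point T₁ → Point T₂
inducedMap T₁ T₂ f ρ p = f ∘ proj₁ p , IsRefinementMorphism.preserves-point ρ p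

-- a map of point spaces is continuous if it is well defined on
-- ≡ₚ-classes and preimages of open sets are open
record Continuous (A B : Triple) (f : Point A → Point B) : Set₁ where
  field
    respects-≡ : ∀ x y → _≡ₚ_ A x y → _≡ₚ_ B (f x) (f y)
    preimage-open : (U : Point B → Set) → IsOpen B U → IsOpen A (U ∘ f)

record IsHomeomorphism (A B : Triple) (f : Point A → Point B) (g : Point B → Point A) : Set₁ where
  field
    f-continuous : Continuous A B f
    g-continuous : Continuous B A g
    left-inverse  : ∀ x → _≡ₚ_ A (g (f x)) x
    right-inverse : ∀ y → _≡ₚ_ B (f (g y)) y

module Trails (T : Triple) (P : IsPreNatural T) where
  open Triple T
  open IsPreNatural P

  ψ : Point T → ℕ → List V
  ψ p n = deduplicate _≟_ (applyUpTo (proj₁ p) n)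

  -- elements of V^≀ : lists of the form ψ_p(n)
  -- (membership proof irrelevant, so equality is equality of lists)
  record Trail : Set where
    constructor mkTrail
    field
      list : List V
      .inV≀ : Σ (Point T) λ p → ∃ λ n → ψ p n ≡ list
  open Trail public

  _≼*_ : Trail → Trail → Set
  a ≼* b = ∃ λ (c : List V) → list a ≡ list b ++ c

  _#*_ : Trail → Trail → Set
  a #* b = Σ V λ x → Σ V λ y → (last (list a) ≡ just x) × (last (list b) ≡ just y) × (x # y)

  TrailTriple : Triple
  TrailTriple = triple Trail _#*_ _≼*_

  ψseq : Point T → ℕ → Trail
  ψseq p n = mkTrail (ψ p n) (p , n , refl)

  lastOr : V → Trail → V
  lastOr ⊤ t with last (list t)
  ... | just x  = x
  ... | nothing = ⊤

-- The trail ψ_p(n) lists the distinct dots among p₀ … pₙ₋₁, so it ends in pₙ₋₁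
-- (the empty trail in ⊤), which lies above pₙ; hence taking ends undoes p ↦ ψ_p up to ≡.
-- Apartness of trails is apartness of their ends, and extending a trail lowers its end.
-- Trails are the strictly decreasing lists, so they are countable and ≼* is decidable; each
-- one occurs as some ψ_w(n), with w obtained by grafting it onto a point below its end (here
-- naturality is used). Refinement morphisms induce continuous maps, so all continuity claims
-- follow from that of p ↦ ψ_p: a point z of ŷₘ need not have a trail through ψ_y(m), but the
-- point y₀ … yₘ zₖ zₖ₊₁ … does, and it is ≡ to z.
module Submission where

open import Defs
open import Data.Nat using (ℕ; zero; suc; _≤_; s≤s; _+_; _∸_; _≤′_; ≤′-refl; ≤′-step)
open import Data.Nat.Properties using (≤-total; ≤⇒≤′; +-comm; m≤m+n; m≤n+m; m≤n⇒m≤1+n; m≤n+m∸n; n<1+n)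
open import Data.Nat.Binary using (ℕᵇ; zero; 2[1+_]; 1+[2_]; toℕ; fromℕ)
open import Data.Nat.Binary.Properties using (fromℕ-toℕ)
open import Data.Product using (Σ; ∃; ∃₂; _×_; _,_; proj₁; proj₂)
open import Data.Sum as Sum using (_⊎_; inj₁; inj₂)
open import Data.List using (List; []; _∷_; [_]; _++_; _∷ʳ_; map; filter; length; applyUpTo; deduplicate; last)
open import Data.List.Properties
  using (++-assoc; ++-identityʳ; ++-identityʳ-unique; ++-conicalʳ;
         filter-all; filter-++; filter-accept; filter-reject; applyUpTo-∷ʳ)
open import Data.List.Membership.Propositional using (_∈_; _∉_)
open import Data.List.Membership.Propositional.Properties using (∈-applyUpTo⁺; ∈-applyUpTo⁻)
open import Data.List.Relation.Unary.Any using (here; there)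
open import Data.List.Relation.Unary.All as All using ()
open import Data.List.Relation.Unary.Linked as Linked using (Linked; []; [-]; _∷_)
open import Data.List.Relation.Unary.Linked.Properties using (Linked⇒All; ++⁺)
open import Data.List.Relation.Binary.Prefix.Heterogeneous.Properties using (prefix?)
open import Data.List.Relation.Binary.Prefix.Propositional.Properties using (Prefix-as-∣ˡ; ∣ˡ-as-Prefix)
open import Data.Maybe using (Maybe; just; nothing; fromMaybe)
open import Data.Maybe.Relation.Binary.Connected using (Connected; just; nothing-just)
open import Data.Empty using (⊥-elim)
open import Relation.Nullary using (¬_; Dec; yes; no; ¬?)
open import Relation.Nullary.Decidable using (map′; recompute)
open import Relation.Binary.Definitions using (DecidableEquality; Transitive)
open import Relation.Binary.PropositionalEquality
  using (_≡_; _≢_; refl; sym; trans; cong; cong₂; subst; subst₂; module ≡-Reasoning)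
open import Function using (_∘_)

-- Countability of lists

incrementHead : List ℕ → List ℕ
incrementHead []       = []
incrementHead (n ∷ ns) = suc n ∷ ns

-- Read from the outermost constructor, each 1+[2_] closes an entry counting the 2[1+_] before it.
runLengths : ℕᵇ → List ℕ
runLengths zero     = []
runLengths 1+[2 x ] = 0 ∷ runLengths x
runLengths 2[1+ x ] = incrementHead (runLengths x)

runLengthCode : List ℕ → ℕᵇ
runLengthCode []       = zero
runLengthCode (n ∷ ns) = entry n
  where
  entry : ℕ → ℕᵇ
  entry zero    = 1+[2 runLengthCode ns ]
  entry (suc k) = 2[1+ entry k ]

runLengths-runLengthCode : ∀ ns → runLengths (runLengthCode ns) ≡ ns
runLengths-runLengthCode []       = refl
runLengths-runLengthCode (n ∷ ns) = entry n
  where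
  entry : ∀ k → runLengths (runLengthCode (k ∷ ns)) ≡ k ∷ ns
  entry zero    = cong (0 ∷_) (runLengths-runLengthCode ns)
  entry (suc k) = cong incrementHead (entry k)

map-onto : ∀ {a} {A : Set a} {e : ℕ → A} → (∀ x → ∃ λ n → e n ≡ x) →
           ∀ xs → ∃ λ ns → map e ns ≡ xs
map-onto onto []       = [] , refl
map-onto onto (x ∷ xs) with onto x | map-onto onto xs
... | n , eₙ≡x | ns , eₙₛ≡xs = n ∷ ns , cong₂ _∷_ eₙ≡x eₙₛ≡xs

enumerateLists : ∀ {a} {A : Set a} → (ℕ → A) → ℕ → List A
enumerateLists e n = map e (runLengths (fromℕ n))

enumerateLists-onto : ∀ {a} {A : Set a} {e : ℕ → A} → (∀ x → ∃ λ n → e n ≡ x) →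
                      ∀ xs → ∃ λ n → enumerateLists e n ≡ xs
enumerateLists-onto {e = e} onto xs with map-onto onto xs
... | ns , eₙₛ≡xs = toℕ (runLengthCode ns) , (begin
  map e (runLengths (fromℕ (toℕ (runLengthCode ns)))) ≡⟨ cong (map e ∘ runLengths) (fromℕ-toℕ (runLengthCode ns)) ⟩
  map e (runLengths (runLengthCode ns))               ≡⟨ cong (map e) (runLengths-runLengthCode ns) ⟩
  map e ns                                            ≡⟨ eₙₛ≡xs ⟩
  xs                                                  ∎)
  where open ≡-Reasoning

-- Deduplication and linked lists

module _ {a} {A : Set a} (_≟_ : DecidableEquality A) where
  open import Data.List.Membership.DecPropositional _≟_ using (_∈?_)

  private
    dedup = deduplicate _≟_

  deduplicate-∷ʳ-∉ : ∀ {y} xs → y ∉ xs → dedup (xs ∷ʳ y) ≡ dedup xs ∷ʳ y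
  deduplicate-∷ʳ-∉ []           y∉ = refl
  deduplicate-∷ʳ-∉ {y} (x ∷ xs) y∉ = cong (x ∷_) (begin
    filter P? (dedup (xs ∷ʳ y))               ≡⟨ cong (filter P?) (deduplicate-∷ʳ-∉ xs (y∉ ∘ there)) ⟩
    filter P? (dedup xs ∷ʳ y)                 ≡⟨ filter-++ P? (dedup xs) [ y ] ⟩
    filter P? (dedup xs) ++ filter P? [ y ]   ≡⟨ cong (filter P? (dedup xs) ++_) (filter-accept P? x≢y) ⟩
    filter P? (dedup xs) ∷ʳ y                 ∎)
    where
    open ≡-Reasoning
    P? = ¬? ∘ (x ≟_)
    x≢y : x ≢ y
    x≢y x≡y = y∉ (here (sym x≡y))

  deduplicate-∷ʳ-∈ : ∀ {y} xs → y ∈ xs → dedup (xs ∷ʳ y) ≡ dedup xs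
  deduplicate-∷ʳ-∈ {y} (x ∷ xs) y∈ = cong (x ∷_) (dropped (y ∈? xs) y∈)
    where
    P? = ¬? ∘ (x ≟_)
    dropped : Dec (y ∈ xs) → y ∈ x ∷ xs → filter P? (dedup (xs ∷ʳ y)) ≡ filter P? (dedup xs)
    dropped (yes y∈xs) _            = cong (filter P?) (deduplicate-∷ʳ-∈ xs y∈xs)
    dropped (no y∉xs)  (there y∈xs) = ⊥-elim (y∉xs y∈xs)
    dropped (no y∉xs)  (here refl)  = begin
      filter P? (dedup (xs ∷ʳ y))             ≡⟨ cong (filter P?) (deduplicate-∷ʳ-∉ xs y∉xs) ⟩
      filter P? (dedup xs ∷ʳ y)               ≡⟨ filter-++ P? (dedup xs) [ y ] ⟩
      filter P? (dedup xs) ++ filter P? [ y ] ≡⟨ cong (filter P? (dedup xs) ++_) (filter-reject P? (λ y≢y → y≢y refl)) ⟩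
      filter P? (dedup xs) ++ []              ≡⟨ ++-identityʳ _ ⟩
      filter P? (dedup xs)                    ∎
      where open ≡-Reasoning

  deduplicate-Linked : ∀ {r} {R : A → A → Set r} → Transitive R → (∀ {x y} → R x y → x ≢ y) →
                       ∀ {xs} → Linked R xs → dedup xs ≡ xs
  deduplicate-Linked R-trans R⇒≢ []  = refl
  deduplicate-Linked R-trans R⇒≢ [-] = refl
  deduplicate-Linked R-trans R⇒≢ {x ∷ xs} (r ∷ rs) = cong (x ∷_) (begin
    filter P? (dedup xs) ≡⟨ cong (filter P?) (deduplicate-Linked R-trans R⇒≢ rs) ⟩
    filter P? xs         ≡⟨ filter-all P? (All.map R⇒≢ (Linked⇒All R-trans r rs)) ⟩
    xs                   ∎)
    where
    open ≡-Reasoning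
    P? = ¬? ∘ (x ≟_)

Linked-∷ʳ⁺ : ∀ {a r} {A : Set a} {R : A → A → Set r} {xs v} →
             Linked R xs → (∀ {y} → last xs ≡ just y → R y v) → Linked R (xs ∷ʳ v)
Linked-∷ʳ⁺ {R = R} {xs} {v} rs last-R = ++⁺ rs (connected (last xs) last-R) [-]
  where
  connected : ∀ m → (∀ {y} → m ≡ just y → R y v) → Connected R m (just v)
  connected nothing  _      = nothing-just
  connected (just y) last-R = just (last-R refl)

last-∷ʳ : ∀ {a} {A : Set a} (xs : List A) {x} → last (xs ∷ʳ x) ≡ just x
last-∷ʳ []           = refl
last-∷ʳ (_ ∷ [])     = refl
last-∷ʳ (_ ∷ y ∷ xs) = last-∷ʳ (y ∷ xs)

-- Points and continuity

open-≡ₚ-closed : ∀ {A} {U : Point A → Set} → IsOpen A U → ∀ {x y} → U x → _≡ₚ_ A y x → U y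
open-≡ₚ-closed U-open {x} {y} Ux y≡x with U-open x y Ux
... | inj₁ y#x         = ⊥-elim (y≡x y#x)
... | inj₂ (m , hat⊆U) = hat⊆U y (IsPoint.shrinking (proj₂ y) m)

∘-continuous : ∀ {A B C} {g : Point B → Point C} {f : Point A → Point B} →
               Continuous B C g → Continuous A B f → Continuous A C (g ∘ f)
∘-continuous g-continuous f-continuous = record
  { respects-≡    = λ x y x≡y → G.respects-≡ _ _ (F.respects-≡ x y x≡y)
  ; preimage-open = λ U U-open → F.preimage-open _ (G.preimage-open U U-open)
  }
  where
  module G = Continuous g-continuous
  module F = Continuous f-continuous

module PreNatural (T : Triple) (P : IsPreNatural T) where
  open Triple T
  open IsPreNatural P

  _≽_ _≻_ : V → V → Set
  a ≽ b = b ≼ a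
  a ≻ b = b ≺ a

  ≼⇒¬# : ∀ {a b} → a ≼ b → ¬ (a # b)
  ≼⇒¬# {a} a≼b a#b = #-irrefl a (≼-# a≼b a#b)

  ≼-#ˡ : ∀ {a b c} → a ≼ b → b # c → a # c
  ≼-#ˡ a≼b b#c = #-sym (≼-# a≼b (#-sym b#c))

  ≺-≼-trans : ∀ {a b c} → a ≺ b → b ≼ c → a ≺ c
  ≺-≼-trans (a≼b , a≢b) b≼c = ≼-trans a≼b b≼c , λ { refl → a≢b (≼-antisym a≼b b≼c) }

  ≼-≺-trans : ∀ {a b c} → a ≼ b → b ≺ c → a ≺ c
  ≼-≺-trans a≼b (b≼c , b≢c) = ≼-trans a≼b b≼c , λ { refl → b≢c (≼-antisym b≼c a≼b) }

  ≻-trans : Transitive _≻_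
  ≻-trans a≻b b≻c = ≺-≼-trans b≻c (proj₁ a≻b)

  ≻⇒≢ : ∀ {a b} → a ≻ b → a ≢ b
  ≻⇒≢ (_ , b≢a) a≡b = b≢a (sym a≡b)

  _≻?_ : ∀ a b → Dec (a ≻ b)
  a ≻? b with ≼-dec b a | b ≟ a
  ... | yes b≼a | no b≢a  = yes (b≼a , b≢a)
  ... | yes _   | yes b≡a = no λ (_ , b≢a) → b≢a b≡a
  ... | no b⋠a  | _       = no λ (b≼a , _) → b⋠a b≼a

  descending⇒antitone : ∀ {f : ℕ → V} → (∀ n → f (suc n) ≼ f n) → ∀ {i j} → i ≤ j → f j ≼ f i
  descending⇒antitone {f} desc i≤j = antitone (≤⇒≤′ i≤j)
    where
    antitone : ∀ {i j} → i ≤′ j → f j ≼ f i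
    antitone ≤′-refl        = ≼-refl _
    antitone (≤′-step i≤′j) = ≼-trans (desc _) (antitone i≤′j)

  dots-antitone : (p : Point T) → ∀ {i j} → i ≤ j → proj₁ p j ≼ proj₁ p i
  dots-antitone p = descending⇒antitone (IsPoint.descending (proj₂ p))

  dots-not-apart : (p : Point T) → ∀ i j → ¬ (proj₁ p i # proj₁ p j)
  dots-not-apart p i j with ≤-total i j
  ... | inj₁ i≤j = ≼⇒¬# (dots-antitone p i≤j) ∘ #-sym
  ... | inj₂ j≤i = ≼⇒¬# (dots-antitone p j≤i)

  ≡ₚ-if-above : (p w : Point T) → (∀ n → ∃ λ j → proj₁ p j ≼ proj₁ w n) → _≡ₚ_ T p w
  ≡ₚ-if-above p w above (n , pₙ#wₙ) with above n
  ... | j , pⱼ≼wₙ = dots-not-apart p n j (≼-# pⱼ≼wₙ pₙ#wₙ)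

  dropPoint : Point T → ℕ → Point T
  dropPoint (q , q-point) k = (λ n → q (n + k)) , record
    { descending = λ n → descending (n + k)
    ; shrinking  = λ n → let m , qₘ≺ = shrinking (n + k) in m ∸ k , ≼-≺-trans (back m) qₘ≺
    ; locating   = λ a b a#b → let m , h = locating a b a#b in
                                 m ∸ k , Sum.map (≼-#ˡ (back m)) (≼-#ˡ (back m)) h
    }
    where
    open IsPoint q-point
    back : ∀ m → q (m ∸ k + k) ≼ q m
    back m = descending⇒antitone descending (subst (m ≤_) (+-comm k (m ∸ k)) (m≤n+m∸n m k))

  point-from-tail : ∀ {f : ℕ → V} (q : Point T) k → (∀ n → f (suc n) ≼ f n) →
                    (∀ n → f (k + n) ≡ proj₁ q n) → IsPoint T f
  point-from-tail {f} (q , q-point) k desc tail = record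
    { descending = desc
    ; shrinking  = λ n → let m , qₘ≺ = shrinking (n ∸ k) in
        k + m , ≺-≼-trans (subst₂ _≺_ (sym (tail m)) (sym (tail (n ∸ k))) qₘ≺)
                          (descending⇒antitone desc (m≤n+m∸n n k))
    ; locating   = λ a b a#b → let m , h = locating a b a#b in
        k + m , Sum.map (subst (_# a) (sym (tail m))) (subst (_# b) (sym (tail m))) h
    }
    where open IsPoint q-point

  graft : List V → (ℕ → V) → ℕ → V
  graft []       f n       = f n
  graft (x ∷ xs) f zero    = x
  graft (x ∷ xs) f (suc n) = graft xs f n

  graft-tail : ∀ xs f n → graft xs f (length xs + n) ≡ f n
  graft-tail []       f n = refl
  graft-tail (x ∷ xs) f n = graft-tail xs f n

  applyUpTo-graft : ∀ xs f → applyUpTo (graft xs f) (length xs) ≡ xs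
  applyUpTo-graft []       f = refl
  applyUpTo-graft (x ∷ xs) f = cong (x ∷_) (applyUpTo-graft xs f)

  graft-descending : ∀ xs {f} → (∀ n → f (suc n) ≼ f n) → Linked _≽_ (xs ∷ʳ f 0) →
                     ∀ n → graft xs f (suc n) ≼ graft xs f n
  graft-descending []           desc _         n       = desc n
  graft-descending (x ∷ [])     desc (x≽ ∷ _)  zero    = x≽
  graft-descending (x ∷ y ∷ xs) desc (x≽y ∷ _) zero    = x≽y
  graft-descending (x ∷ xs)     desc linked    (suc n) = graft-descending xs desc (Linked.tail linked) n

  graftPoint : (xs : List V) (q : Point T) → Linked _≽_ (xs ∷ʳ proj₁ q 0) → Point T
  graftPoint xs (q , q-point) linked = graft xs q ,
    point-from-tail (q , q-point) (length xs) (graft-descending xs (IsPoint.descending q-point) linked) (graft-tail xs q)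

  graftPoint-above : ∀ xs q linked n → ∃ λ j → proj₁ q j ≼ proj₁ (graftPoint xs q linked) n
  graftPoint-above xs q linked n = n ∸ length xs ,
    subst (_≼ graft xs (proj₁ q) n) (graft-tail xs (proj₁ q) (n ∸ length xs))
          (dots-antitone (graftPoint xs q linked) (m≤n+m∸n n (length xs)))

  inducedMap-continuous : ∀ {S} {f : Triple.V S → V} (ρ : IsRefinementMorphism S T f) →
                          Continuous S T (inducedMap S T f ρ)
  inducedMap-continuous {S} {f} ρ = record
    { respects-≡    = λ x y x≡y (n , h) → x≡y (n , reflects-# h)
    ; preimage-open = preimage-open
    }
    where
    open IsRefinementMorphism ρ
    g = inducedMap S T f ρ
    preimage-open : (U : Point T → Set) → IsOpen T U → IsOpen S (U ∘ g)
    preimage-open U U-open x y Ugx with U-open (g x) (g y) Ugx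
    ... | inj₁ (n , h)       = inj₁ (n , reflects-# h)
    ... | inj₂ (m , hat⊆U) = inj₂ (m , λ z (k , zₖ≺yₘ) →
      let j , h = IsPoint.shrinking (proj₂ (g z)) k in
      hat⊆U (g z) (j , ≺-≼-trans h (preserves-≼ (proj₁ zₖ≺yₘ))))

-- The trail space

module TrailSpace (T : Triple) (N : IsNatural T) where
  open Triple T
  open IsNatural N
  open IsPreNatural preNatural
  open PreNatural T preNatural
  open Trails T preNatural
  open import Data.List.Membership.DecPropositional _≟_ using (_∈?_)

  lastDot : List V → V
  lastDot xs = fromMaybe top (last xs)

  lastDot-∷ʳ : ∀ xs {x} → lastDot (xs ∷ʳ x) ≡ x
  lastDot-∷ʳ xs = cong (fromMaybe top) (last-∷ʳ xs)

  lastDot-≼-head : ∀ {x xs} → Linked _≽_ (x ∷ xs) → lastDot (x ∷ xs) ≼ x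
  lastDot-≼-head [-]            = ≼-refl _
  lastDot-≼-head (x≽y ∷ linked) = ≼-trans (lastDot-≼-head linked) x≽y

  lastDot-++-≼ : ∀ xs {ys} → Linked _≽_ (xs ++ ys) → lastDot (xs ++ ys) ≼ lastDot xs
  lastDot-++-≼ []           _      = top-max _
  lastDot-++-≼ (x ∷ [])     linked = lastDot-≼-head linked
  lastDot-++-≼ (x ∷ y ∷ xs) linked = lastDot-++-≼ (y ∷ xs) (Linked.tail linked)

  lastDot-++-≺ : ∀ xs {y ys} → xs ≢ [] → Linked _≻_ (xs ++ y ∷ ys) → lastDot (xs ++ y ∷ ys) ≺ lastDot xs
  lastDot-++-≺ []            xs≢[] _              = ⊥-elim (xs≢[] refl)
  lastDot-++-≺ (x ∷ [])      _     (x≻y ∷ linked) = ≼-≺-trans (lastDot-≼-head (Linked.map proj₁ linked)) x≻y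
  lastDot-++-≺ (x ∷ x′ ∷ xs) _     linked         = lastDot-++-≺ (x′ ∷ xs) (λ ()) (Linked.tail linked)

  Linked-≽-∷ʳ : ∀ {xs v} → Linked _≻_ xs → v ≼ lastDot xs → Linked _≽_ (xs ∷ʳ v)
  Linked-≽-∷ʳ {v = v} linked v≼ =
    Linked-∷ʳ⁺ (Linked.map proj₁ linked) (λ last≡y → subst (v ≼_) (cong (fromMaybe top) last≡y) v≼)

  top-not-apart : ∀ {a} → ¬ (top # a)
  top-not-apart {a} top#a = ≼⇒¬# (top-max a) (#-sym top#a)

  fromMaybe-top-apart : ∀ (m m′ : Maybe V) → fromMaybe top m # fromMaybe top m′ →
                        ∃₂ λ x y → m ≡ just x × m′ ≡ just y × x # y
  fromMaybe-top-apart (just x) (just y) x#y = x , y , refl , refl , x#y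
  fromMaybe-top-apart nothing  _        h   = ⊥-elim (top-not-apart h)
  fromMaybe-top-apart (just x) nothing  h   = ⊥-elim (top-not-apart (#-sym h))

  ψ-suc : ∀ p n → ψ p (suc n) ≡ deduplicate _≟_ (applyUpTo (proj₁ p) n ∷ʳ proj₁ p n)
  ψ-suc p n = cong (deduplicate _≟_) (sym (applyUpTo-∷ʳ (proj₁ p) n))

  ψ-suc-∈ : ∀ p n → proj₁ p n ∈ applyUpTo (proj₁ p) n → ψ p (suc n) ≡ ψ p n
  ψ-suc-∈ p n repeated = trans (ψ-suc p n) (deduplicate-∷ʳ-∈ _≟_ _ repeated)

  ψ-suc-∉ : ∀ p n → proj₁ p n ∉ applyUpTo (proj₁ p) n → ψ p (suc n) ≡ ψ p n ∷ʳ proj₁ p n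
  ψ-suc-∉ p n fresh = trans (ψ-suc p n) (deduplicate-∷ʳ-∉ _≟_ _ fresh)

  repeated-dot : (p : Point T) → ∀ {n} → proj₁ p (suc n) ∈ applyUpTo (proj₁ p) (suc n) →
                 proj₁ p (suc n) ≡ proj₁ p n
  repeated-dot p {n} repeated with ∈-applyUpTo⁻ (proj₁ p) repeated
  ... | i , s≤s i≤n , pₙ₊₁≡pᵢ =
    ≼-antisym (IsPoint.descending (proj₂ p) n) (subst (proj₁ p n ≼_) (sym pₙ₊₁≡pᵢ) (dots-antitone p i≤n))

  fresh-dot : (p : Point T) → ∀ {n} → proj₁ p (suc n) ∉ applyUpTo (proj₁ p) (suc n) →
              proj₁ p n ≻ proj₁ p (suc n)
  fresh-dot (p , p-point) {n} fresh = IsPoint.descending p-point n ,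
    λ pₙ₊₁≡pₙ → fresh (subst (_∈ applyUpTo p (suc n)) (sym pₙ₊₁≡pₙ) (∈-applyUpTo⁺ p (n<1+n n)))

  lastDot-ψ-suc : (p : Point T) → ∀ n → lastDot (ψ p (suc n)) ≡ proj₁ p n
  lastDot-ψ-suc p n with proj₁ p n ∈? applyUpTo (proj₁ p) n
  ... | no fresh = trans (cong lastDot (ψ-suc-∉ p n fresh)) (lastDot-∷ʳ (ψ p n))
  lastDot-ψ-suc p zero    | yes ()
  lastDot-ψ-suc p (suc n) | yes repeated = begin
    lastDot (ψ p (suc (suc n))) ≡⟨ cong lastDot (ψ-suc-∈ p (suc n) repeated) ⟩
    lastDot (ψ p (suc n))       ≡⟨ lastDot-ψ-suc p n ⟩
    proj₁ p n                   ≡⟨ sym (repeated-dot p repeated) ⟩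
    proj₁ p (suc n)             ∎
    where open ≡-Reasoning

  ψ-linked : (p : Point T) → ∀ n → Linked _≻_ (ψ p n)
  ψ-linked p zero = []
  ψ-linked p (suc n) with proj₁ p n ∈? applyUpTo (proj₁ p) n
  ... | yes repeated = subst (Linked _≻_) (sym (ψ-suc-∈ p n repeated)) (ψ-linked p n)
  ... | no fresh     =
    subst (Linked _≻_) (sym (ψ-suc-∉ p n fresh)) (Linked-∷ʳ⁺ (ψ-linked p n) (last-above n fresh))
    where
    last-above : ∀ n → proj₁ p n ∉ applyUpTo (proj₁ p) n → ∀ {y} → last (ψ p n) ≡ just y → y ≻ proj₁ p n
    last-above zero    _     ()
    last-above (suc n) fresh last≡y =
      subst (_≻ proj₁ p (suc n)) (trans (sym (lastDot-ψ-suc p n)) (cong (fromMaybe top) last≡y)) (fresh-dot p fresh)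

  ψ-extends : ∀ p n → ∃ λ c → ψ p (suc n) ≡ ψ p n ++ c
  ψ-extends p n with proj₁ p n ∈? applyUpTo (proj₁ p) n
  ... | yes repeated = [] , trans (ψ-suc-∈ p n repeated) (sym (++-identityʳ _))
  ... | no fresh     = [ proj₁ p n ] , ψ-suc-∉ p n fresh

  ψ-graftPoint : ∀ xs q linked → Linked _≻_ xs → ψ (graftPoint xs q linked) (length xs) ≡ xs
  ψ-graftPoint xs q linked strict =
    trans (cong (deduplicate _≟_) (applyUpTo-graft xs (proj₁ q))) (deduplicate-Linked _≟_ ≻-trans ≻⇒≢ strict)

  pointBelow : ∀ a → Σ (Point T) λ q → proj₁ q 0 ≼ a
  pointBelow a with hat-inhabited a
  ... | q , k , qₖ≺a = dropPoint q k , proj₁ qₖ≺a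

  pointWithTrail : ∀ xs → Linked _≻_ xs → Σ (Point T) λ w → ψ w (length xs) ≡ xs
  pointWithTrail xs strict with pointBelow (lastDot xs)
  ... | q , q₀≼ = graftPoint xs q linked , ψ-graftPoint xs q linked strict
    where linked = Linked-≽-∷ʳ strict q₀≼

  _≺*_ : Trail → Trail → Set
  _≺*_ = Triple._≺_ TrailTriple

  trail-≡ : ∀ {a b : Trail} → list a ≡ list b → a ≡ b
  trail-≡ {mkTrail xs _} refl = refl

  trail-linked : ∀ t → Linked _≻_ (list t)
  trail-linked (mkTrail xs inV≀) =
    recompute (Linked.linked? _≻?_ xs) (let p , n , ψₚₙ≡xs = inV≀ in subst (Linked _≻_) ψₚₙ≡xs (ψ-linked p n))

  toTrail : ∀ xs → Linked _≻_ xs → Trail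
  toTrail xs strict = mkTrail xs (let w , ψw≡xs = pointWithTrail xs strict in w , length xs , ψw≡xs)

  emptyTrail : Trail
  emptyTrail = toTrail [] []

  fromList : List V → Trail
  fromList xs with Linked.linked? _≻?_ xs
  ... | yes strict = toTrail xs strict
  ... | no _       = emptyTrail

  fromList-list : ∀ t → fromList (list t) ≡ t
  fromList-list t with Linked.linked? _≻?_ (list t)
  ... | yes _         = trail-≡ refl
  ... | no not-linked = ⊥-elim (not-linked (trail-linked t))

  end : Trail → V
  end = lastOr top

  end-lastDot : ∀ t → end t ≡ lastDot (list t)
  end-lastDot t with last (list t)
  ... | just x  = refl
  ... | nothing = refl

  #*⇒end# : ∀ a b → a #* b → end a # end b
  #*⇒end# a b (x , y , lastₐ≡x , last_b≡y , x#y) =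
    subst₂ _#_ (sym (trans (end-lastDot a) (cong (fromMaybe top) lastₐ≡x)))
               (sym (trans (end-lastDot b) (cong (fromMaybe top) last_b≡y))) x#y

  end#⇒#* : ∀ a b → end a # end b → a #* b
  end#⇒#* a b h = fromMaybe-top-apart (last (list a)) (last (list b)) (subst₂ _#_ (end-lastDot a) (end-lastDot b) h)

  end-monotone : ∀ a b → a ≼* b → end a ≼ end b
  end-monotone a b (c , a≡b++c) = subst₂ _≼_ (sym (end-lastDot a)) (sym (end-lastDot b))
    (subst (λ xs → lastDot xs ≼ lastDot (list b)) (sym a≡b++c)
           (lastDot-++-≼ (list b) (subst (Linked _≽_) a≡b++c (Linked.map proj₁ (trail-linked a)))))

  ≼*-antisym : ∀ {a b} → a ≼* b → b ≼* a → a ≡ b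
  ≼*-antisym {a} {b} (c , a≡b++c) (d , b≡a++d) with ++-conicalʳ d c (++-identityʳ-unique (list a) (begin
    list a             ≡⟨ a≡b++c ⟩
    list b ++ c        ≡⟨ cong (_++ c) b≡a++d ⟩
    (list a ++ d) ++ c ≡⟨ ++-assoc (list a) d c ⟩
    list a ++ d ++ c   ∎))
    where open ≡-Reasoning
  ... | refl = trail-≡ (trans a≡b++c (++-identityʳ (list b)))

  ≼*-dec : ∀ a b → Dec (a ≼* b)
  ≼*-dec a b = map′ (λ b⊑a → let record { quotient = c ; equality = b++c≡a } = Prefix-as-∣ˡ b⊑a in c , sym b++c≡a)
                    (λ (c , a≡b++c) → ∣ˡ-as-Prefix (record { quotient = c ; equality = sym a≡b++c }))
                    (prefix? _≟_ (list b) (list a))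

  trailPreNatural : IsPreNatural TrailTriple
  trailPreNatural = record
    { enum      = fromList ∘ enumerateLists enum
    ; enum-onto = λ t → let n , e = enumerateLists-onto enum-onto (list t) in
                        n , trans (cong fromList e) (fromList-list t)
    ; #-dec     = λ a b → map′ (end#⇒#* a b) (#*⇒end# a b) (#-dec (end a) (end b))
    ; ≼-dec     = ≼*-dec
    ; #-sym     = λ {a} {b} → end#⇒#* b a ∘ #-sym ∘ #*⇒end# a b
    ; #-irrefl  = λ a → #-irrefl (end a) ∘ #*⇒end# a a
    ; ≼-refl    = λ a → [] , sym (++-identityʳ (list a))
    ; ≼-trans   = λ { {a} {b} {c} (d , a≡b++d) (e , b≡c++e) →
                    e ++ d , trans a≡b++d (trans (cong (_++ d) b≡c++e) (++-assoc (list c) e d)) }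
    ; ≼-antisym = ≼*-antisym
    ; ≼-#       = λ {a} {b} {c} a≼*b c#*b → end#⇒#* c a (≼-# (end-monotone a b a≼*b) (#*⇒end# c b c#*b))
    }

  module TrailOrder = PreNatural TrailTriple trailPreNatural

  ψseq-antitone : ∀ p {i j} → i ≤ j → ψseq p j ≼* ψseq p i
  ψseq-antitone p = TrailOrder.descending⇒antitone {ψseq p} (ψ-extends p)

  end-ψseq-suc : ∀ p n → end (ψseq p (suc n)) ≡ proj₁ p n
  end-ψseq-suc p n = trans (end-lastDot (ψseq p (suc n))) (lastDot-ψ-suc p n)

  dot-≼-end-ψseq : ∀ p n → proj₁ p n ≼ end (ψseq p n)
  dot-≼-end-ψseq p zero    = top-max _
  dot-≼-end-ψseq p (suc n) = subst (proj₁ p (suc n) ≼_) (sym (end-ψseq-suc p n)) (IsPoint.descending (proj₂ p) n)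

  ψseq-apart : ∀ x y n → ψseq x n #* ψseq y n → proj₁ x n # proj₁ y n
  ψseq-apart x y n h =
    ≼-# (dot-≼-end-ψseq y n) (≼-#ˡ (dot-≼-end-ψseq x n) (#*⇒end# (ψseq x n) (ψseq y n) h))

  end-ψseq-≺ : ∀ p {m n} → proj₁ p m ≺ proj₁ p n → end (ψseq p (suc (n + m))) ≺ end (ψseq p n)
  end-ψseq-≺ p {m} {n} pₘ≺pₙ = subst (_≺ end (ψseq p n)) (sym (end-ψseq-suc p (n + m)))
    (≼-≺-trans (dots-antitone p (m≤n+m m n)) (≺-≼-trans pₘ≺pₙ (dot-≼-end-ψseq p n)))

  ψseq-point : (p : Point T) → IsPoint TrailTriple (ψseq p)
  ψseq-point p = record
    { descending = ψ-extends p
    ; shrinking  = shrinking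
    ; locating   = locating
    }
    where
    open IsPoint (proj₂ p) using () renaming (shrinking to shrinkingₚ; locating to locatingₚ)
    shrinking : ∀ n → ∃ λ m → ψseq p m ≺* ψseq p n
    shrinking n with shrinkingₚ n
    ... | m , pₘ≺pₙ = suc (n + m) , ψseq-antitone p (m≤n⇒m≤1+n (m≤m+n n m)) , proj₂ (end-ψseq-≺ p pₘ≺pₙ) ∘ cong end
    locating : ∀ a b → a #* b → ∃ λ m → (ψseq p m #* a) ⊎ (ψseq p m #* b)
    locating a b a#*b with locatingₚ (end a) (end b) (#*⇒end# a b a#*b)
    ... | m , pₘ#end = suc m , Sum.map (end#⇒#* (ψseq p (suc m)) a ∘ subst (_# end a) (sym (end-ψseq-suc p m)))
                                       (end#⇒#* (ψseq p (suc m)) b ∘ subst (_# end b) (sym (end-ψseq-suc p m))) pₘ#end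

  ψPoint : Point T → Point TrailTriple
  ψPoint p = ψseq p , ψseq-point p

  trailNatural : IsNatural TrailTriple
  trailNatural = record
    { preNatural    = trailPreNatural
    ; top           = emptyTrail
    ; top-max       = λ a → list a , refl
    ; hat-inhabited = λ t → let w , ψw≡t = pointWithTrail (list t) (trail-linked t) in
        ψPoint w , subst (λ s → hat TrailTriple s (ψPoint w)) (trail-≡ ψw≡t)
                         (IsPoint.shrinking (ψseq-point w) (length (list t)))
    }

  ≺*-extension : ∀ {a b} → b ≺* a → ∃₂ λ x d → list b ≡ list a ++ x ∷ d
  ≺*-extension     ((x ∷ d , b≡a++xd) , _) = x , d , b≡a++xd
  ≺*-extension {a} (([] , b≡a++[]) , b≢a) = ⊥-elim (b≢a (trail-≡ (trans b≡a++[] (++-identityʳ (list a)))))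

  ≺*-nonempty : ∀ {a b} → b ≺* a → list b ≢ []
  ≺*-nonempty {a} b≺*a b≡[] with ≺*-extension b≺*a
  ... | x , d , b≡a++xd with () ← ++-conicalʳ (list a) (x ∷ d) (trans (sym b≡a++xd) b≡[])

  end-strict : ∀ {a b} → b ≺* a → list a ≢ [] → end b ≺ end a
  end-strict {a} {b} b≺*a a≢[] with ≺*-extension b≺*a
  ... | x , d , b≡a++xd = subst₂ _≺_ (sym (end-lastDot b)) (sym (end-lastDot a))
    (subst (λ xs → lastDot xs ≺ lastDot (list a)) (sym b≡a++xd)
           (lastDot-++-≺ (list a) a≢[] (subst (Linked _≻_) b≡a++xd (trail-linked b))))

  -- The step [⊤] ≺* [] keeps the end ⊤, so one step need not decrease the end strictly.
  end-≺-twice : ∀ {a b c} → c ≺* b → b ≺* a → end c ≺ end a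
  end-≺-twice {a} {b} c≺*b b≺*a = ≺-≼-trans (end-strict c≺*b (≺*-nonempty b≺*a)) (end-monotone b a (proj₁ b≺*a))

  end-refinement : IsRefinementMorphism TrailTriple T end
  end-refinement = record
    { reflects-#      = λ {a} {b} → end#⇒#* a b
    ; preserves-≼     = λ {a} {b} → end-monotone a b
    ; preserves-point = λ (P , P-point) → let open IsPoint P-point in record
      { descending = λ n → end-monotone (P (suc n)) (P n) (descending n)
      ; shrinking  = λ n → let m , Pₘ≺Pₙ = shrinking n
                               k , Pₖ≺Pₘ = shrinking m
                           in k , end-≺-twice Pₖ≺Pₘ Pₘ≺Pₙ
      ; locating   = λ x y x#y →
          let m , h = locating (singletonTrail x) (singletonTrail y) (x , y , refl , refl , x#y)
          in m , Sum.map (#*⇒end# (P m) (singletonTrail x)) (#*⇒end# (P m) (singletonTrail y)) h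
      }
    }
    where
    singletonTrail : V → Trail
    singletonTrail x = toTrail [ x ] [-]

  ψPoint-respects-≡ : ∀ x y → _≡ₚ_ T x y → _≡ₚ_ TrailTriple (ψPoint x) (ψPoint y)
  ψPoint-respects-≡ x y x≡y (n , h) = x≡y (n , ψseq-apart x y n h)

  hat-approximation : ∀ y m z → hat T (proj₁ y m) z →
                      Σ (Point T) λ w → _≡ₚ_ T z w × hat TrailTriple (ψseq y m) (ψPoint w)
  hat-approximation y m z (k , zₖ≺yₘ) = w , ≡ₚ-if-above z w above , in-hat
    where
    t = ψ y (suc m)
    t-linked = ψ-linked y (suc m)
    zₖ₊ = dropPoint z k
    linked = Linked-≽-∷ʳ t-linked (subst (proj₁ z k ≼_) (sym (lastDot-ψ-suc y m)) (proj₁ zₖ≺yₘ))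
    w = graftPoint t zₖ₊ linked
    above : ∀ n → ∃ λ j → proj₁ z j ≼ proj₁ w n
    above n = let j , zⱼ₊ₖ≼wₙ = graftPoint-above t zₖ₊ linked n in j + k , zⱼ₊ₖ≼wₙ
    ψw≡ψy : ψseq w (length t) ≡ ψseq y (suc m)
    ψw≡ψy = trail-≡ (ψ-graftPoint t zₖ₊ linked t-linked)
    in-hat : hat TrailTriple (ψseq y m) (ψPoint w)
    in-hat = let j , ψw≺* = IsPoint.shrinking (ψseq-point w) (length t) in
      j , TrailOrder.≺-≼-trans {ψseq w j} (subst (ψseq w j ≺*_) ψw≡ψy ψw≺*) (ψ-extends y m)

  ψPoint-continuous : Continuous T TrailTriple ψPoint
  ψPoint-continuous = record { respects-≡ = ψPoint-respects-≡ ; preimage-open = preimage-open }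
    where
    preimage-open : (U : Point TrailTriple → Set) → IsOpen TrailTriple U → IsOpen T (U ∘ ψPoint)
    preimage-open U U-open x y Uψx with U-open (ψPoint x) (ψPoint y) Uψx
    ... | inj₁ (n , h)       = inj₁ (n , ψseq-apart y x n h)
    ... | inj₂ (m , hat⊆U) = inj₂ (m , λ z z∈ŷₘ →
      let w , z≡w , ψw∈hat = hat-approximation y m z z∈ŷₘ in
      open-≡ₚ-closed U-open (hat⊆U (ψPoint w) ψw∈hat) (ψPoint-respects-≡ z w z≡w))

  ψPoint-homeomorphism : IsHomeomorphism T TrailTriple ψPoint (inducedMap TrailTriple T end end-refinement)
  ψPoint-homeomorphism = record
    { f-continuous  = ψPoint-continuous
    ; g-continuous  = inducedMap-continuous end-refinement
    ; left-inverse  = λ x (n , h) → ≼⇒¬# (dot-≼-end-ψseq x n) (#-sym h)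
    ; right-inverse = λ P (n , h) → let x = inducedMap TrailTriple T end end-refinement P in
        ≼⇒¬# (dot-≼-end-ψseq x n) (#-sym (#*⇒end# (ψseq x n) (proj₁ P n) h))
    }

mainTheorem3 : (T : Triple) (N : IsNatural T) →
    let open Trails T (IsNatural.preNatural N) in
    Σ (IsNatural TrailTriple) λ _ →
    Σ ((p : Point T) → IsPoint TrailTriple (ψseq p)) λ φ →
    Σ (IsRefinementMorphism TrailTriple T (lastOr (IsNatural.top N))) λ ρ →
    IsHomeomorphism T TrailTriple (λ p → ψseq p , φ p)
      (inducedMap TrailTriple T (lastOr (IsNatural.top N)) ρ)
    × ((W : Triple) → IsNatural W →
       (f : Trail → Triple.V W) (σ : IsRefinementMorphism TrailTriple W f) →
       Continuous T W (λ p → inducedMap TrailTriple W f σ (ψseq p , φ p)))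
mainTheorem3 T N = trailNatural , ψseq-point , end-refinement , ψPoint-homeomorphism ,
  λ W W-natural f σ →
    ∘-continuous (PreNatural.inducedMap-continuous W (IsNatural.preNatural W-natural) σ) ψPoint-continuous
  where open TrailSpace T N
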